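{- Let $\mathsf V$ be a variety of FL${}_{\mathrm e}$-algebras. Then $(\mathsf V,\Rightarrow_{\wedge})$ is proto-connexive if and only if $(\mathsf V,\Rightarrow_{\circ})$ is proto-connexive and $\mathsf V$ satisfies the identity $x\leq\neg\neg 1$.
   Context: An FL${}_{\mathrm e}$-algebra is an algebra $\langle A,\wedge,\vee,\cdot,\to,0,1\rangle$ such that $\langle A,\wedge,\vee\rangle$ is a lattice (with order $\leq$), $\langle A,\cdot,1\rangle$ is a commutative monoid, $0$ is an arbitrary constant, and $x\cdot y\leq z\iff x\leq y\to z$. Write $\neg x:=x\to 0$, $x\Rightarrow_{\wedge} y:=(x\to y)\wedge(y\to\neg\neg x)$ and $x\Rightarrow_{\circ} y:=(x\to y)\cdot(y\to\neg\neg x)$. For a binary operation ${\Rightarrow}$, an algebra $\mathbf A$ is proto-connexive for ${\Rightarrow}$ if for all $x,y$: $1\leq\neg(x{\Rightarrow}\neg x)$, $1\leq\neg(\neg x{\Rightarrow} x)$, $1\leq (x{\Rightarrow} y){\Rightarrow}\neg(x{\Rightarrow}\neg y)$, $1\leq (x{\Rightarrow}\neg y){\Rightarrow}\neg(x{\Rightarrow} y)$; $(\mathsf V,{\Rightarrow})$ is proto-connexive if every member of $\mathsf V$ is. -}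

module Defs where

open import Level using (Level; _⊔_) renaming (suc to lsuc)
open import Data.Nat using (ℕ)
open import Data.Product using (_×_; _,_)
open import Relation.Binary.PropositionalEquality using (_≡_)
open import Algebra.Core using (Op₂)
open import Algebra.Lattice.Structures using (IsLattice)
open import Algebra.Structures using (IsCommutativeMonoid)

record FLe (c : Level) : Set (lsuc c) where
  infixr 5 _⇒_
  infixl 7 _·_
  infixr 6 _∧_
  infixr 6 _∨_
  infix 4 _≤_
  infix 8 ¬_
  field
    Carrier : Set c
    _∧_ _∨_ _·_ _⇒_ : Op₂ Carrier
    0# 1# : Carrier
    isLattice : IsLattice _≡_ _∨_ _∧_
    isCommutativeMonoid : IsCommutativeMonoid _≡_ _·_ 1#

  _≤_ : Carrier → Carrier → Set c
  x ≤ y = x ∧ y ≡ x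

  field
    residuated→ : ∀ x y z → (x · y) ≤ z → x ≤ (y ⇒ z)
    residuated← : ∀ x y z → x ≤ (y ⇒ z) → (x · y) ≤ z

  ¬_ : Carrier → Carrier
  ¬ x = x ⇒ 0#

  _⇒∧_ : Op₂ Carrier
  x ⇒∧ y = (x ⇒ y) ∧ (y ⇒ ¬ (¬ x))

  _⇒∘_ : Op₂ Carrier
  x ⇒∘ y = (x ⇒ y) · (y ⇒ ¬ (¬ x))

ProtoConnexive : ∀ {c} (A : FLe c) → Op₂ (FLe.Carrier A) → Set c
ProtoConnexive A _⇛_ =
  (∀ x → 1# ≤ ¬ (x ⇛ (¬ x))) ×
  (∀ x → 1# ≤ ¬ ((¬ x) ⇛ x)) ×
  (∀ x y → 1# ≤ ((x ⇛ y) ⇛ (¬ (x ⇛ (¬ y))))) ×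
  (∀ x y → 1# ≤ ((x ⇛ (¬ y)) ⇛ (¬ (x ⇛ y))))
  where open FLe A

data Term : Set where
  var : ℕ → Term
  _∧ₜ_ _∨ₜ_ _·ₜ_ _⇒ₜ_ : Term → Term → Term
  0ₜ 1ₜ : Term

⟦_⟧ : ∀ {c} {A : FLe c} → Term → (ℕ → FLe.Carrier A) → FLe.Carrier A
⟦_⟧ {A = A} (var i) ρ = ρ i
⟦_⟧ {A = A} (s ∧ₜ t) ρ = FLe._∧_ A (⟦_⟧ {A = A} s ρ) (⟦_⟧ {A = A} t ρ)
⟦_⟧ {A = A} (s ∨ₜ t) ρ = FLe._∨_ A (⟦_⟧ {A = A} s ρ) (⟦_⟧ {A = A} t ρ)
⟦_⟧ {A = A} (s ·ₜ t) ρ = FLe._·_ A (⟦_⟧ {A = A} s ρ) (⟦_⟧ {A = A} t ρ)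
⟦_⟧ {A = A} (s ⇒ₜ t) ρ = FLe._⇒_ A (⟦_⟧ {A = A} s ρ) (⟦_⟧ {A = A} t ρ)
⟦_⟧ {A = A} 0ₜ ρ = FLe.0# A
⟦_⟧ {A = A} 1ₜ ρ = FLe.1# A

Equation : Set
Equation = Term × Term

_⊨_ : ∀ {c} (A : FLe c) → Equation → Set c
A ⊨ (s , t) = ∀ (ρ : ℕ → FLe.Carrier A) → ⟦_⟧ {A = A} s ρ ≡ ⟦_⟧ {A = A} t ρ

-- A variety of FL_e-algebras (Birkhoff: equational class), presented by a
-- set E of equations: its members (at carrier level c) are the FL_e-algebras
-- satisfying every equation of E.
InVariety : ∀ {c ℓ} → (Equation → Set ℓ) → FLe c → Set (c ⊔ ℓ)
InVariety E A = ∀ e → E e → A ⊨ e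

VProtoConnexive∧ : ∀ {ℓ} (c : Level) → (Equation → Set ℓ) → Set (lsuc c ⊔ ℓ)
VProtoConnexive∧ c E = ∀ (A : FLe c) → InVariety E A → ProtoConnexive A (FLe._⇒∧_ A)

VProtoConnexive∘ : ∀ {ℓ} (c : Level) → (Equation → Set ℓ) → Set (lsuc c ⊔ ℓ)
VProtoConnexive∘ c E = ∀ (A : FLe c) → InVariety E A → ProtoConnexive A (FLe._⇒∘_ A)

VSatisfiesX≤¬¬1 : ∀ {ℓ} (c : Level) → (Equation → Set ℓ) → Set (lsuc c ⊔ ℓ)
VSatisfiesX≤¬¬1 c E = ∀ (A : FLe c) → InVariety E A →
  ∀ x → FLe._≤_ A x (FLe.¬_ A (FLe.¬_ A (FLe.1# A)))

-- For ⇒∧ the third and fourth clauses both say ¬ (x ⇒∧ y) ≡ ¬ ¬ (x ⇒∧ ¬ y), since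
-- 1 ≤ u ⇒∧ ¬ v amounts to ¬ u ≡ ¬ ¬ v. The same holds for ⇒∘ as soon as 0 is absorbing
-- (0 · x ≤ 0, equivalently x ≤ ¬ ¬ 1): then both factors of u ⇒∘ ¬ v absorb products,
-- so their product is above 1 only when both are. Proto-connexivity then depends only on
-- the negations ¬ (x ⇛ y), and it suffices to show ¬ (x ⇒∧ y) ≡ ¬ (x ⇒∘ y).
-- Absorbency of 0 follows from the third ⇒∧-clause at x = 0; the first clause of either
-- implication gives x ∧ ¬ x ≤ 0, which yields ¬ (a · b) ≤ ¬ (a ∧ b); the converse
-- inequality ¬ (x ⇒∧ y) ≤ ¬ (x ⇒∘ y) comes from the third clause of the implication
-- assumed proto-connexive.

module Submission where

open import Defs
open import Level using (Level)
open import Data.Product using (_×_; _,_)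
open import Function.Bundles using (_⇔_; mk⇔; module Equivalence)
open import Relation.Binary.PropositionalEquality
  using (_≡_; sym; subst; subst₂; isEquivalence)
open import Relation.Binary.Bundles using (Poset)
open import Relation.Binary.Structures using (IsPartialOrder)
open import Algebra.Core using (Op₂)
open import Algebra.Bundles using (CommutativeMonoid)
open import Algebra.Lattice.Bundles using (Lattice)
open import Algebra.Structures using (IsCommutativeMonoid)
import Algebra.Lattice.Properties.Lattice as LatticeProperties
import Algebra.Properties.CommutativeSemigroup as CommutativeSemigroupProperties
import Relation.Binary.Construct.NaturalOrder.Left as LeftNaturalOrder
import Relation.Binary.Reasoning.PartialOrder as PartialOrderReasoning

module FLeProperties {c : Level} (A : FLe c) where

  open FLe A

  private
    variable
      x y z u v w a b : Carrier

  private
    lattice : Lattice c c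
    lattice = record { Carrier = Carrier ; _≈_ = _≡_ ; _∨_ = _∨_ ; _∧_ = _∧_ ; isLattice = isLattice }

    open LatticeProperties lattice using (∧-isSemilattice)
    module ∧-Order = LeftNaturalOrder _≡_ _∧_
    module ∧-PartialOrder = IsPartialOrder (∧-Order.isPartialOrder ∧-isSemilattice)

  -- Here x ≤ y is x ∧ y ≡ x, whereas the library's natural order is x ≡ x ∧ y.
  ≤-isPartialOrder : IsPartialOrder _≡_ _≤_
  ≤-isPartialOrder = record
    { isPreorder = record
      { isEquivalence = isEquivalence
      ; reflexive     = λ x≡y → sym (∧-PartialOrder.reflexive x≡y)
      ; trans         = λ x≤y y≤z → sym (∧-PartialOrder.trans (sym x≤y) (sym y≤z))
      }
    ; antisym = λ x≤y y≤x → ∧-PartialOrder.antisym (sym x≤y) (sym y≤x)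
    }

  ≤-poset : Poset c c c
  ≤-poset = record { isPartialOrder = ≤-isPartialOrder }

  open Poset ≤-poset
    using () renaming (refl to ≤-refl; reflexive to ≤-reflexive; trans to ≤-trans; antisym to ≤-antisym)
  open PartialOrderReasoning ≤-poset

  x∧y≤x : x ∧ y ≤ x
  x∧y≤x {x} {y} = sym (∧-Order.x∙y≤x ∧-isSemilattice x y)

  x∧y≤y : x ∧ y ≤ y
  x∧y≤y {x} {y} = sym (∧-Order.x∙y≤y ∧-isSemilattice x y)

  ∧-greatest : z ≤ x → z ≤ y → z ≤ x ∧ y
  ∧-greatest {z} z≤x z≤y = sym (∧-Order.∙-presʳ-≤ ∧-isSemilattice z (sym z≤x) (sym z≤y))

  open IsCommutativeMonoid isCommutativeMonoid using (assoc; comm; identityˡ; identityʳ)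

  private
    commutativeMonoid : CommutativeMonoid c c
    commutativeMonoid = record
      { Carrier = Carrier ; _≈_ = _≡_ ; _∙_ = _·_ ; ε = 1# ; isCommutativeMonoid = isCommutativeMonoid }

  open CommutativeSemigroupProperties (CommutativeMonoid.commutativeSemigroup commutativeMonoid)
    using (interchange; xy∙z≈xz∙y; xy∙z≈zy∙x; xy∙z≈y∙xz; xy∙z≈yz∙x)

  ⇒-eval : (x ⇒ y) · x ≤ y
  ⇒-eval {x} {y} = residuated← (x ⇒ y) x y ≤-refl

  ⇒-eval′ : x · (x ⇒ y) ≤ y
  ⇒-eval′ {x} {y} = ≤-trans (≤-reflexive (comm x (x ⇒ y))) ⇒-eval

  ·-monoˡ-≤ : x ≤ y → x · z ≤ y · z
  ·-monoˡ-≤ {x} {y} {z} x≤y = residuated← x z (y · z) (≤-trans x≤y (residuated→ y z (y · z) ≤-refl))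

  ·-monoʳ-≤ : x ≤ y → z · x ≤ z · y
  ·-monoʳ-≤ {x} {y} {z} x≤y = begin
    z · x ≡⟨ comm z x ⟩
    x · z ≤⟨ ·-monoˡ-≤ x≤y ⟩
    y · z ≡⟨ comm y z ⟩
    z · y ∎

  ·-mono-≤ : x ≤ y → u ≤ v → x · u ≤ y · v
  ·-mono-≤ x≤y u≤v = ≤-trans (·-monoˡ-≤ x≤y) (·-monoʳ-≤ u≤v)

  ⇒-monoʳ-≤ : y ≤ z → x ⇒ y ≤ x ⇒ z
  ⇒-monoʳ-≤ {y} {z} {x} y≤z = residuated→ (x ⇒ y) x z (≤-trans ⇒-eval y≤z)

  1≤⇒⁺ : x ≤ y → 1# ≤ x ⇒ y
  1≤⇒⁺ {x} {y} x≤y = residuated→ 1# x y (≤-trans (≤-reflexive (identityˡ x)) x≤y)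

  1≤⇒⁻ : 1# ≤ x ⇒ y → x ≤ y
  1≤⇒⁻ {x} {y} 1≤x⇒y = ≤-trans (≤-reflexive (sym (identityˡ x))) (residuated← 1# x y 1≤x⇒y)

  1⇒x≤x : 1# ⇒ x ≤ x
  1⇒x≤x {x} = ≤-trans (≤-reflexive (sym (identityʳ (1# ⇒ x)))) ⇒-eval

  1≤·⁺ : 1# ≤ a → 1# ≤ b → 1# ≤ a · b
  1≤·⁺ 1≤a 1≤b = ≤-trans (≤-reflexive (sym (identityˡ 1#))) (·-mono-≤ 1≤a 1≤b)

  ≤¬⁺ : x · y ≤ 0# → x ≤ ¬ y
  ≤¬⁺ {x} {y} = residuated→ x y 0#

  ≤¬⁻ : x ≤ ¬ y → x · y ≤ 0#
  ≤¬⁻ {x} {y} = residuated← x y 0#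

  ¬-galois : x ≤ ¬ y → y ≤ ¬ x
  ¬-galois {x} {y} x≤¬y = ≤¬⁺ (≤-trans (≤-reflexive (comm y x)) (≤¬⁻ x≤¬y))

  ¬-antitone : x ≤ y → ¬ y ≤ ¬ x
  ¬-antitone x≤y = ≤¬⁺ (≤-trans (·-monoʳ-≤ x≤y) ⇒-eval)

  x≤¬¬x : x ≤ ¬ ¬ x
  x≤¬¬x = ¬-galois ≤-refl

  ¬¬¬x≡¬x : ¬ ¬ ¬ x ≡ ¬ x
  ¬¬¬x≡¬x = ≤-antisym (¬-antitone x≤¬¬x) x≤¬¬x

  ¬1≤0 : ¬ 1# ≤ 0#
  ¬1≤0 = 1⇒x≤x

  0≤¬1 : 0# ≤ ¬ 1#
  0≤¬1 = ≤¬⁺ (≤-reflexive (identityʳ 0#))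

  1≤¬0 : 1# ≤ ¬ 0#
  1≤¬0 = ≤¬⁺ (≤-reflexive (identityˡ 0#))

  ¬¬0≤0 : ¬ ¬ 0# ≤ 0#
  ¬¬0≤0 = ≤-trans (¬-antitone 1≤¬0) ¬1≤0

  ⇒·¬≤¬ : (x ⇒ y) · ¬ y ≤ ¬ x
  ⇒·¬≤¬ {x} {y} = ≤¬⁺ (begin
    ((x ⇒ y) · ¬ y) · x ≡⟨ xy∙z≈xz∙y (x ⇒ y) (¬ y) x ⟩
    ((x ⇒ y) · x) · ¬ y ≤⟨ ·-monoˡ-≤ ⇒-eval ⟩
    y · ¬ y             ≤⟨ ⇒-eval′ ⟩
    0#                  ∎)

  ¬¬⇒·≤¬¬ : ¬ ¬ (x ⇒ y) · x ≤ ¬ ¬ y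
  ¬¬⇒·≤¬¬ {x} {y} = ≤¬⁺ (begin
    (¬ ¬ (x ⇒ y) · x) · ¬ y ≡⟨ assoc _ x (¬ y) ⟩
    ¬ ¬ (x ⇒ y) · (x · ¬ y) ≤⟨ ·-monoʳ-≤ x·¬y≤¬[x⇒y] ⟩
    ¬ ¬ (x ⇒ y) · ¬ (x ⇒ y) ≤⟨ ⇒-eval ⟩
    0#                      ∎)
    where
    x·¬y≤¬[x⇒y] : x · ¬ y ≤ ¬ (x ⇒ y)
    x·¬y≤¬[x⇒y] = ≤¬⁺ (begin
      (x · ¬ y) · (x ⇒ y) ≡⟨ xy∙z≈zy∙x x (¬ y) (x ⇒ y) ⟩
      ((x ⇒ y) · ¬ y) · x ≤⟨ ·-monoˡ-≤ ⇒·¬≤¬ ⟩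
      ¬ x · x             ≤⟨ ⇒-eval ⟩
      0#                  ∎)

  ·¬·≤¬ : x · ¬ (x · y) ≤ ¬ y
  ·¬·≤¬ {x} {y} = ≤¬⁺ (≤-trans (≤-reflexive (xy∙z≈xz∙y x (¬ (x · y)) y)) ⇒-eval′)

  -- Clauses of the form 1 ≤ u ⇛ ¬ v

  ContrarietyCriterion : Op₂ Carrier → Set c
  ContrarietyCriterion _⇛_ = ∀ u v → (1# ≤ u ⇛ (¬ v)) ⇔ (¬ u ≡ ¬ ¬ v)

  ≤¬×¬≤¬¬⇔¬≡¬¬ : (u ≤ ¬ v × ¬ v ≤ ¬ ¬ u) ⇔ (¬ u ≡ ¬ ¬ v)
  ≤¬×¬≤¬¬⇔¬≡¬¬ = mk⇔
    (λ (u≤¬v , ¬v≤¬¬u) → ≤-antisym (¬-galois ¬v≤¬¬u) (¬-antitone u≤¬v))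
    (λ ¬u≡¬¬v → subst (_ ≤_) ¬¬¬x≡¬x (¬-galois (≤-reflexive (sym ¬u≡¬¬v)))
              , ¬-galois (≤-reflexive ¬u≡¬¬v))

  ⇒∧-contrariety : ContrarietyCriterion _⇒∧_
  ⇒∧-contrariety u v = mk⇔
    (λ 1≤u⇒∧¬v → Equivalence.to ≤¬×¬≤¬¬⇔¬≡¬¬
      (1≤⇒⁻ (≤-trans 1≤u⇒∧¬v x∧y≤x) , 1≤⇒⁻ (≤-trans 1≤u⇒∧¬v x∧y≤y)))
    (λ ¬u≡¬¬v → let (u≤¬v , ¬v≤¬¬u) = Equivalence.from ≤¬×¬≤¬¬⇔¬≡¬¬ ¬u≡¬¬v
                in ∧-greatest (1≤⇒⁺ u≤¬v) (1≤⇒⁺ ¬v≤¬¬u))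

  -- All four clauses only see the negations ¬ (x ⇛ y).
  protoConnexive-transfer : {_⇛₁_ _⇛₂_ : Op₂ Carrier} →
    ContrarietyCriterion _⇛₁_ → ContrarietyCriterion _⇛₂_ →
    (∀ x y → ¬ (x ⇛₁ y) ≡ ¬ (x ⇛₂ y)) →
    ProtoConnexive A _⇛₁_ → ProtoConnexive A _⇛₂_
  protoConnexive-transfer {_⇛₁_} {_⇛₂_} criterion₁ criterion₂ ¬-agree (pc₁ , pc₂ , pc₃ , pc₄) =
      (λ x → subst (1# ≤_) (¬-agree x (¬ x)) (pc₁ x))
    , (λ x → subst (1# ≤_) (¬-agree (¬ x) x) (pc₂ x))
    , (λ x y → transport (¬-agree x y) (¬-agree x (¬ y)) (pc₃ x y))
    , (λ x y → transport (¬-agree x (¬ y)) (¬-agree x y) (pc₄ x y))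
    where
    transport : ∀ {u₁ v₁ u₂ v₂} → ¬ u₁ ≡ ¬ u₂ → ¬ v₁ ≡ ¬ v₂ →
                1# ≤ u₁ ⇛₁ (¬ v₁) → 1# ≤ u₂ ⇛₂ (¬ v₂)
    transport ¬u₁≡¬u₂ ¬v₁≡¬v₂ 1≤u₁⇛₁¬v₁ = Equivalence.from (criterion₂ _ _)
      (subst₂ (λ s t → s ≡ ¬ t) ¬u₁≡¬u₂ ¬v₁≡¬v₂ (Equivalence.to (criterion₁ _ _) 1≤u₁⇛₁¬v₁))

  Absorbing : Carrier → Set c
  Absorbing a = ∀ w → a · w ≤ a

  Regular : Carrier → Set c
  Regular a = ¬ ¬ a ≤ a

  ⇒-absorbing : Absorbing a → Absorbing (x ⇒ a)
  ⇒-absorbing {a} {x} a-absorbing w = residuated→ ((x ⇒ a) · w) x a (begin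
    ((x ⇒ a) · w) · x ≡⟨ xy∙z≈xz∙y (x ⇒ a) w x ⟩
    ((x ⇒ a) · x) · w ≤⟨ ·-monoˡ-≤ ⇒-eval ⟩
    a · w             ≤⟨ a-absorbing w ⟩
    a                 ∎)

  ¬-regular : Regular (¬ x)
  ¬-regular = ≤-reflexive ¬¬¬x≡¬x

  ⇒-regular : Regular a → Regular (x ⇒ a)
  ⇒-regular {a} {x} a-regular = residuated→ (¬ ¬ (x ⇒ a)) x a (≤-trans ¬¬⇒·≤¬¬ a-regular)

  1≤·⇒1≤∧ : Absorbing a → Absorbing b → 1# ≤ a · b → 1# ≤ a ∧ b
  1≤·⇒1≤∧ {a} {b} a-absorbing b-absorbing 1≤a·b = ≤-trans 1≤a·b (∧-greatest (a-absorbing b) (begin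
    a · b ≡⟨ comm a b ⟩
    b · a ≤⟨ b-absorbing a ⟩
    b     ∎))

  1≤∧⇒1≤· : 1# ≤ a ∧ b → 1# ≤ a · b
  1≤∧⇒1≤· 1≤a∧b = 1≤·⁺ (≤-trans 1≤a∧b x∧y≤x) (≤-trans 1≤a∧b x∧y≤y)

  ≤¬¬1⇔0-absorbing : (∀ x → x ≤ ¬ ¬ 1#) ⇔ Absorbing 0#
  ≤¬¬1⇔0-absorbing = mk⇔
    (λ ≤¬¬1 w → begin
      0# · w   ≤⟨ ·-monoˡ-≤ 0≤¬1 ⟩
      ¬ 1# · w ≡⟨ comm (¬ 1#) w ⟩
      w · ¬ 1# ≤⟨ ≤¬⁻ (≤¬¬1 w) ⟩
      0#       ∎)
    (λ 0-absorbing x → ≤¬⁺ (begin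
      x · ¬ 1# ≤⟨ ·-monoʳ-≤ ¬1≤0 ⟩
      x · 0#   ≡⟨ comm x 0# ⟩
      0# · x   ≤⟨ 0-absorbing x ⟩
      0#       ∎))

  -- Algebras in which 0# is absorbing, i.e. satisfying x ≤ ¬ ¬ 1#

  module Absorbing0 (0-absorbing : Absorbing 0#) where

    0≤¬ : 0# ≤ ¬ x
    0≤¬ {x} = ≤¬⁺ (0-absorbing x)

    ¬-absorbing : Absorbing (¬ x)
    ¬-absorbing = ⇒-absorbing 0-absorbing

    ⇒¬-absorbing : Absorbing (x ⇒ ¬ y)
    ⇒¬-absorbing = ⇒-absorbing ¬-absorbing

    ·≤¬¬ : x · w ≤ ¬ ¬ x
    ·≤¬¬ {x} {w} = ≤¬⁺ (begin
      (x · w) · ¬ x ≡⟨ xy∙z≈zy∙x x w (¬ x) ⟩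
      (¬ x · w) · x ≤⟨ ·-monoˡ-≤ (¬-absorbing w) ⟩
      ¬ x · x       ≤⟨ ⇒-eval ⟩
      0#            ∎)

    ⇒∘-contrariety : ContrarietyCriterion _⇒∘_
    ⇒∘-contrariety u v = mk⇔
      (λ 1≤u⇒∘¬v → Equivalence.to (⇒∧-contrariety u v) (1≤·⇒1≤∧ ⇒¬-absorbing ⇒¬-absorbing 1≤u⇒∘¬v))
      (λ ¬u≡¬¬v → 1≤∧⇒1≤· (Equivalence.from (⇒∧-contrariety u v) ¬u≡¬¬v))

    ≤⇒∧¬-self : w · w ≤ 0# → w ≤ w ⇒∧ (¬ w)
    ≤⇒∧¬-self {w} w·w≤0 =
      ∧-greatest (residuated→ w w (¬ w) (≤-trans w·w≤0 0≤¬)) (residuated→ w (¬ w) (¬ ¬ w) ·≤¬¬)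

    ≤⇒∘¬-self : w · w ≤ 0# → w ≤ w ⇒∘ (¬ w)
    ≤⇒∘¬-self {w} w·w≤0 = begin
      w                          ≡⟨ identityˡ w ⟨
      1# · w                     ≤⟨ ·-mono-≤ (1≤⇒⁺ (≤¬⁺ w·w≤0)) (residuated→ w (¬ w) (¬ ¬ w) ·≤¬¬) ⟩
      (w ⇒ ¬ w) · (¬ w ⇒ ¬ ¬ w)  ∎

    clause₁⇒∧¬≤0 : {_⇛_ : Op₂ Carrier} → (∀ {w} → w · w ≤ 0# → w ≤ w ⇛ (¬ w)) →
                   (∀ x → 1# ≤ ¬ (x ⇛ (¬ x))) → ∀ x → x ∧ ¬ x ≤ 0#
    clause₁⇒∧¬≤0 {_⇛_} ≤⇛¬-self clause₁ x = ≤-trans (≤⇛¬-self w·w≤0) (1≤⇒⁻ (clause₁ (x ∧ ¬ x)))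
      where
      w·w≤0 : (x ∧ ¬ x) · (x ∧ ¬ x) ≤ 0#
      w·w≤0 = ≤-trans (·-mono-≤ x∧y≤x x∧y≤y) ⇒-eval′

    module NoContradictions (∧¬≤0 : ∀ x → x ∧ ¬ x ≤ 0#) where

      ≤¬∧≤¬¬⇒≤0 : w ≤ ¬ x → w ≤ ¬ ¬ x → w ≤ 0#
      ≤¬∧≤¬¬⇒≤0 {x = x} w≤¬x w≤¬¬x = ≤-trans (∧-greatest w≤¬x w≤¬¬x) (∧¬≤0 (¬ x))

      x·x≤0⇒x≤0 : x · x ≤ 0# → x ≤ 0#
      x·x≤0⇒x≤0 x·x≤0 = ≤¬∧≤¬¬⇒≤0 (≤¬⁺ x·x≤0) x≤¬¬x

      ¬[x·x]≤¬x : ¬ (x · x) ≤ ¬ x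
      ¬[x·x]≤¬x {x} = ≤¬⁺ (≤¬∧≤¬¬⇒≤0 {x = x}
        (≤¬⁺ (≤-trans (≤-reflexive (assoc (¬ (x · x)) x x)) ⇒-eval))
        (≤-trans (≤-reflexive (comm (¬ (x · x)) x)) ·≤¬¬))

      ¬·≤¬∧ : ¬ (a · b) ≤ ¬ (a ∧ b)
      ¬·≤¬∧ = ≤-trans (¬-antitone (·-mono-≤ x∧y≤x x∧y≤y)) ¬[x·x]≤¬x

      ¬¬⇒·⇒¬≤¬ : ¬ ¬ (x ⇒ y) · (x ⇒ ¬ y) ≤ ¬ x
      ¬¬⇒·⇒¬≤¬ {x} {y} = ≤-trans (≤¬⁺ (begin
        (¬ ¬ (x ⇒ y) · (x ⇒ ¬ y)) · (x · x) ≡⟨ interchange (¬ ¬ (x ⇒ y)) (x ⇒ ¬ y) x x ⟩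
        (¬ ¬ (x ⇒ y) · x) · ((x ⇒ ¬ y) · x) ≤⟨ ·-mono-≤ ¬¬⇒·≤¬¬ ⇒-eval ⟩
        ¬ ¬ y · ¬ y                         ≤⟨ ⇒-eval ⟩
        0#                                  ∎)) ¬[x·x]≤¬x

      -- Reasoning by cases on y and ¬ y, made possible by ∧¬≤0.
      ⇒-cases : (y ⇒ z) · (¬ y ⇒ z) ≤ ¬ ¬ z
      ⇒-cases {y} {z} = ≤¬⁺ (≤¬∧≤¬¬⇒≤0 {x = y}
        (begin
          ((y ⇒ z) · (¬ y ⇒ z)) · ¬ z ≡⟨ xy∙z≈xz∙y (y ⇒ z) (¬ y ⇒ z) (¬ z) ⟩
          ((y ⇒ z) · ¬ z) · (¬ y ⇒ z) ≤⟨ ·-monoˡ-≤ ⇒·¬≤¬ ⟩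
          ¬ y · (¬ y ⇒ z)             ≤⟨ ¬-absorbing _ ⟩
          ¬ y                         ∎)
        (begin
          ((y ⇒ z) · (¬ y ⇒ z)) · ¬ z ≡⟨ xy∙z≈yz∙x (y ⇒ z) (¬ y ⇒ z) (¬ z) ⟩
          ((¬ y ⇒ z) · ¬ z) · (y ⇒ z) ≤⟨ ·-monoˡ-≤ ⇒·¬≤¬ ⟩
          ¬ ¬ y · (y ⇒ z)             ≤⟨ ¬-absorbing _ ⟩
          ¬ ¬ y                       ∎))

      ≤¬[⇒∧¬] : w ≤ ¬ ¬ (x ⇒ y) → w ≤ y ⇒ ¬ ¬ x → w ≤ ¬ (x ⇒∧ (¬ y))
      ≤¬[⇒∧¬] {w} {x} {y} w≤¬¬[x⇒y] w≤y⇒¬¬x = ≤¬⁺ (≤¬∧≤¬¬⇒≤0 {x = x}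
        (≤-trans (·-mono-≤ w≤¬¬[x⇒y] x∧y≤x) ¬¬⇒·⇒¬≤¬)
        (begin
          w · (x ⇒∧ (¬ y))            ≤⟨ ·-mono-≤ w≤y⇒¬¬x x∧y≤y ⟩
          (y ⇒ ¬ ¬ x) · (¬ y ⇒ ¬ ¬ x) ≤⟨ ⇒-cases ⟩
          ¬ ¬ ¬ ¬ x                   ≡⟨ ¬¬¬x≡¬x ⟩
          ¬ ¬ x                       ∎))

      ¬⇒∧≤¬⇒∘ : (∀ x y → ¬ (x ⇒∧ y) · ¬ (x ⇒∧ (¬ y)) ≤ 0#) → ¬ (x ⇒∧ y) ≤ ¬ (x ⇒∘ y)
      ¬⇒∧≤¬⇒∘ {x} {y} clause₃ = ≤¬⁺ (≤-trans (≤-reflexive (comm (¬ (x ⇒∧ y)) (x ⇒∘ y))) t≤0)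
        where
        p q t : Carrier
        p = x ⇒ y
        q = y ⇒ ¬ ¬ x
        t = (p · q) · ¬ (x ⇒∧ y)

        t≤¬[x⇒∧y] : t ≤ ¬ (x ⇒∧ y)
        t≤¬[x⇒∧y] = ≤-trans (≤-reflexive (comm (p · q) _)) (¬-absorbing (p · q))

        t≤¬¬p : t ≤ ¬ ¬ p
        t≤¬¬p = ≤-trans (≤-reflexive (assoc p q _)) ·≤¬¬

        t≤q : t ≤ q
        t≤q = ≤-trans (≤-reflexive (xy∙z≈y∙xz p q _)) (⇒¬-absorbing (p · ¬ (x ⇒∧ y)))

        t≤0 : t ≤ 0#
        t≤0 = x·x≤0⇒x≤0 (≤-trans (·-mono-≤ t≤¬[x⇒∧y] (≤¬[⇒∧¬] t≤¬¬p t≤q)) (clause₃ x y))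

    ¬[∧1]≤¬ : Regular a → ¬ (a ⇒∘ 1#) ≤ ¬ ¬ (a ⇒∘ (¬ 1#)) → ¬ (a ∧ 1#) ≤ ¬ a
    ¬[∧1]≤¬ {a} a-regular clause₃ = begin
      ¬ (a ∧ 1#)          ≤⟨ ¬-antitone (∧-greatest a⇒∘1≤a a⇒∘1≤1) ⟩
      ¬ (a ⇒∘ 1#)         ≤⟨ clause₃ ⟩
      ¬ ¬ (a ⇒∘ (¬ 1#))   ≤⟨ ¬-antitone (¬-antitone a⇒∘¬1≤¬a) ⟩
      ¬ ¬ ¬ a             ≡⟨ ¬¬¬x≡¬x ⟩
      ¬ a                 ∎
      where
      1⇒¬¬a≤a : 1# ⇒ ¬ ¬ a ≤ a
      1⇒¬¬a≤a = ≤-trans 1⇒x≤x a-regular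

      a⇒∘1≤a : a ⇒∘ 1# ≤ a
      a⇒∘1≤a = begin
        (a ⇒ 1#) · (1# ⇒ ¬ ¬ a) ≡⟨ comm (a ⇒ 1#) _ ⟩
        (1# ⇒ ¬ ¬ a) · (a ⇒ 1#) ≤⟨ ⇒¬-absorbing (a ⇒ 1#) ⟩
        1# ⇒ ¬ ¬ a              ≤⟨ 1⇒¬¬a≤a ⟩
        a                       ∎

      a⇒∘1≤1 : a ⇒∘ 1# ≤ 1#
      a⇒∘1≤1 = ≤-trans (·-monoʳ-≤ 1⇒¬¬a≤a) ⇒-eval

      a⇒∘¬1≤¬a : a ⇒∘ (¬ 1#) ≤ ¬ a
      a⇒∘¬1≤¬a = ≤-trans (⇒¬-absorbing _) (⇒-monoʳ-≤ ¬1≤0)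

    ¬⇒∧≤¬⇒∘′ : (∀ x y → ¬ (x ⇒∘ y) ≡ ¬ ¬ (x ⇒∘ (¬ y))) → ¬ (x ⇒∧ y) ≤ ¬ (x ⇒∘ y)
    ¬⇒∧≤¬⇒∘′ {x} {y} clause₃ = ≤¬⁺ (begin
      ¬ (p ∧ q) · (p · q)           ≡⟨ comm _ (p · q) ⟩
      (p · q) · ¬ (p ∧ q)           ≤⟨ ·-monoʳ-≤ (¬-antitone p·[q∧1]≤p∧q) ⟩
      (p · q) · ¬ (p · (q ∧ 1#))    ≡⟨ xy∙z≈y∙xz p q _ ⟩
      q · (p · ¬ (p · (q ∧ 1#)))    ≤⟨ ·-monoʳ-≤ ·¬·≤¬ ⟩
      q · ¬ (q ∧ 1#)                ≤⟨ ·-monoʳ-≤ (¬[∧1]≤¬ (⇒-regular ¬-regular) (≤-reflexive (clause₃ q 1#))) ⟩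
      q · ¬ q                       ≤⟨ ⇒-eval′ ⟩
      0#                            ∎)
      where
      p q : Carrier
      p = x ⇒ y
      q = y ⇒ ¬ ¬ x

      p·[q∧1]≤p∧q : p · (q ∧ 1#) ≤ p ∧ q
      p·[q∧1]≤p∧q = ∧-greatest
        (≤-trans (·-monoʳ-≤ x∧y≤y) (≤-reflexive (identityʳ p)))
        (≤-trans (·-monoʳ-≤ x∧y≤x) (≤-trans (≤-reflexive (comm p q)) (⇒¬-absorbing p)))

  ¬⇒∧·¬⇒∧¬≤0 : ProtoConnexive A _⇒∧_ → ∀ x y → ¬ (x ⇒∧ y) · ¬ (x ⇒∧ (¬ y)) ≤ 0#
  ¬⇒∧·¬⇒∧¬≤0 (_ , _ , pc₃ , _) x y = ≤¬⁻ (≤-reflexive (Equivalence.to (⇒∧-contrariety _ _) (pc₃ x y)))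

  -- The third clause at x = 0# and y = 0# ∧ ¬ w, where 0# ⇒∧ ¬ y ≤ 0# and 0# ⇒∧ y ≤ 0# ⇒ ¬ w.
  protoConnexive∧⇒0-absorbing : ProtoConnexive A _⇒∧_ → Absorbing 0#
  protoConnexive∧⇒0-absorbing pc w = begin
    0# · w        ≡⟨ identityʳ (0# · w) ⟨
    (0# · w) · 1# ≤⟨ ·-mono-≤ 0·w≤¬P (≤¬⁺ (≤-trans (≤-reflexive (identityˡ Q)) Q≤0)) ⟩
    ¬ P · ¬ Q     ≤⟨ ¬⇒∧·¬⇒∧¬≤0 pc 0# d ⟩
    0#            ∎
    where
    d P Q : Carrier
    d = 0# ∧ ¬ w
    P = 0# ⇒∧ d
    Q = 0# ⇒∧ (¬ d)

    Q≤0 : Q ≤ 0#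
    Q≤0 = begin
      Q                    ≤⟨ x∧y≤y ⟩
      ¬ d ⇒ ¬ ¬ 0#         ≡⟨ identityʳ _ ⟨
      (¬ d ⇒ ¬ ¬ 0#) · 1#  ≤⟨ ·-monoʳ-≤ (≤-trans 1≤¬0 (¬-antitone x∧y≤x)) ⟩
      (¬ d ⇒ ¬ ¬ 0#) · ¬ d ≤⟨ ⇒-eval ⟩
      ¬ ¬ 0#               ≤⟨ ¬¬0≤0 ⟩
      0#                   ∎

    0·w≤¬P : 0# · w ≤ ¬ P
    0·w≤¬P = ≤¬⁺ (begin
      (0# · w) · P          ≤⟨ ·-monoʳ-≤ (≤-trans x∧y≤x (⇒-monoʳ-≤ x∧y≤y)) ⟩
      (0# · w) · (0# ⇒ ¬ w) ≡⟨ xy∙z≈y∙xz 0# w _ ⟩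
      w · (0# · (0# ⇒ ¬ w)) ≤⟨ ·-monoʳ-≤ ⇒-eval′ ⟩
      w · ¬ w               ≤⟨ ⇒-eval′ ⟩
      0#                    ∎)

  protoConnexive∧⇒protoConnexive∘ : ProtoConnexive A _⇒∧_ → ProtoConnexive A _⇒∘_
  protoConnexive∧⇒protoConnexive∘ pc@(pc₁ , _) =
    protoConnexive-transfer ⇒∧-contrariety ⇒∘-contrariety ¬⇒∧≡¬⇒∘ pc
    where
    open Absorbing0 (protoConnexive∧⇒0-absorbing pc)
    open NoContradictions (clause₁⇒∧¬≤0 {_⇒∧_} ≤⇒∧¬-self pc₁)

    ¬⇒∧≡¬⇒∘ : ∀ x y → ¬ (x ⇒∧ y) ≡ ¬ (x ⇒∘ y)
    ¬⇒∧≡¬⇒∘ x y = ≤-antisym (¬⇒∧≤¬⇒∘ (¬⇒∧·¬⇒∧¬≤0 pc)) ¬·≤¬∧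

  protoConnexive∘⇒protoConnexive∧ : Absorbing 0# → ProtoConnexive A _⇒∘_ → ProtoConnexive A _⇒∧_
  protoConnexive∘⇒protoConnexive∧ 0-absorbing pc@(pc₁ , _ , pc₃ , _) =
    protoConnexive-transfer ⇒∘-contrariety ⇒∧-contrariety ¬⇒∘≡¬⇒∧ pc
    where
    open Absorbing0 0-absorbing
    open NoContradictions (clause₁⇒∧¬≤0 {_⇒∘_} ≤⇒∘¬-self pc₁)

    ¬⇒∘≡¬⇒∧ : ∀ x y → ¬ (x ⇒∘ y) ≡ ¬ (x ⇒∧ y)
    ¬⇒∘≡¬⇒∧ x y = ≤-antisym ¬·≤¬∧
      (¬⇒∧≤¬⇒∘′ (λ u v → Equivalence.to (⇒∘-contrariety _ _) (pc₃ u v)))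

open FLeProperties
  using (≤¬¬1⇔0-absorbing; protoConnexive∧⇒0-absorbing;
         protoConnexive∧⇒protoConnexive∘; protoConnexive∘⇒protoConnexive∧)

corollary3p19 : ∀ {ℓ} (c : Level) (E : Equation → Set ℓ) →
    VProtoConnexive∧ c E ⇔ (VProtoConnexive∘ c E × VSatisfiesX≤¬¬1 c E)
corollary3p19 c E = mk⇔
  (λ pc∧ → (λ A A∈V → protoConnexive∧⇒protoConnexive∘ A (pc∧ A A∈V))
         , (λ A A∈V → Equivalence.from (≤¬¬1⇔0-absorbing A) (protoConnexive∧⇒0-absorbing A (pc∧ A A∈V))))
  (λ (pc∘ , ≤¬¬1) A A∈V →
    protoConnexive∘⇒protoConnexive∧ A (Equivalence.to (≤¬¬1⇔0-absorbing A) (≤¬¬1 A A∈V)) (pc∘ A A∈V))
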